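{- Let $V$ be a set with $|V|=n$ and let $H_1=(V,E_1),\dots,H_n=(V,E_n)$ be any undirected hypergraphs on vertex set $V$. Then there exists a directed hypergraph $G$ on $2n$ vertices such that, given a $(1\pm\varepsilon)$ cut-sketch for $G$, for any $i\in\{1,\dots,n\}$ and any $S\subseteq V$ one can recover $\mathrm{cut}_{H_i}(S)$ to within additive error $3\varepsilon|E_i|$.
   Context: For an (unweighted) undirected hypergraph $H=(V,E)$ with hyperedges $e\subseteq V$ and $S\subseteq V$, $\mathrm{cut}_H(S)=|\{e\in E: e\cap S\ne\emptyset,\ e\not\subseteq S\}|$. A directed hypergraph has directed hyperedges $e=(L(e),R(e))$ with $L(e),R(e)$ subsets of its vertex set $U$; for $S\subseteq U$, $\mathrm{cut}_G(S)$ is the number of hyperedges $e$ with $L(e)\cap S\ne\emptyset$ and $R(e)\cap(U\setminus S)\ne\emptyset$. A $(1\pm\varepsilon)$ cut-sketch of $G$ is a data structure from which, for any $S\subseteq U$, one can deterministically recover $\mathrm{cut}_G(S)$ to within a $(1\pm\varepsilon)$ factor using only the data structure and $S$. -}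

module Defs where

open import Data.Nat using (ℕ)
open import Data.Integer using (+_)
open import Data.Product using (_×_; proj₁; proj₂)
open import Data.List using (List; filter)
open import Data.Fin.Subset using (Subset; Nonempty; _∩_; _⊆_; ∁)
open import Data.Fin.Subset.Properties using (nonempty?; _⊆?_)
open import Data.Rational using (ℚ; _/_)
open import Relation.Nullary using (¬_; ¬?)
open import Relation.Nullary.Decidable using (_×-dec_)
import Data.List as L

UHypergraph : ℕ → Set
UHypergraph n = List (Subset n)

DHypergraph : ℕ → Set
DHypergraph m = List (Subset m × Subset m)

numEdges : ∀ {n} → UHypergraph n → ℕ
numEdges = L.length

cutU : ∀ {n} → UHypergraph n → Subset n → ℕ
cutU E S = L.length (filter (λ e → nonempty? (e ∩ S) ×-dec ¬? (e ⊆? S)) E)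

cutD : ∀ {m} → DHypergraph m → Subset m → ℕ
cutD G S = L.length (filter (λ e → nonempty? (proj₁ e ∩ S) ×-dec nonempty? (proj₂ e ∩ ∁ S)) G)

toℚ : ℕ → ℚ
toℚ k = (+ k) / 1

-- G has vertex set V ⊎ V′, with V′ a twin copy of V, and for every i and every e ∈ E_i the
-- arc ({i′}, e). The set X ∪ {i′} is cut exactly by the arcs of H_i whose head e is not
-- contained in X, so the sketch of G approximates out_i(X) = #{e ∈ E_i : e ⊄ X} ≤ |E_i|
-- within a factor 1 ± ε. A hyperedge crosses S iff it lies in neither S nor V ∖ S, and it is
-- nonempty iff it misses at least one of them; so by inclusion–exclusion
-- cut_{H_i}(S) = out_i(S) + out_i(V ∖ S) − out_i(∅), and combining three sketch values
-- costs an additive error of at most 3ε|E_i|.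
module Submission where

open import Defs
open import Data.Nat using (ℕ)
open import Data.Nat as ℕ using ()
open import Data.Fin using (Fin)
open import Data.Fin.Subset using (Subset)
open import Data.Rational using (ℚ; 0ℚ; 1ℚ; _≤_; _<_; _*_; _-_; _+_; ∣_∣)
open import Data.Product using (Σ; _×_)

open import Data.Bool using (true; false; _∧_; not)
open import Data.Empty using (⊥-elim)
open import Data.Fin using (zero; suc; _↑ˡ_; _↑ʳ_)
open import Data.Fin.Properties using (suc-injective)
open import Data.Fin.Subset using (Nonempty; _∩_; _⊆_; ∁; ⊥; ⁅_⁆; _∈_)
open import Data.Fin.Subset.Properties
  using (nonempty?; _⊆?_; ∉⊥; ∩-zeroˡ; x∈p∩q⁺; x∈p∩q⁻; x∈p⇒x∉∁p; x∉p⇒x∈∁p; x∉∁p⇒x∈p; x∈⁅x⁆; x∈⁅y⁆⇒x≡y)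
open import Data.Integer as ℤ using (+_)
import Data.Integer.Properties as ℤ
open import Data.List as List using (List; []; _∷_; length; filter; map; concat; tabulate)
open import Data.List.Properties using (length-filter; filter-++; filter-none; filter-≐; ++-identityʳ)
open import Data.List.Relation.Unary.All using (All; universal)
open import Data.List.Relation.Unary.All.Properties using (concat⁺; tabulate⁺; map⁺)
import Data.Nat.Coprimality as Coprimality
import Data.Nat.Properties as ℕ
open import Data.Product using (_,_; proj₁; proj₂)
open import Data.Rational using (mkℚ; toℚᵘ; -_; *≤*; nonNegative)
open import Data.Rational.Properties
  using (normalize-coprime; toℚᵘ-injective; toℚᵘ-homo-+; ∣p∣≡p∨∣p∣≡-p; ∣p+q∣≤∣p∣+∣q∣; ∣p-q∣≤∣p∣+∣q∣;
         +-monoˡ-≤; +-monoʳ-≤; +-mono-≤; neg-antimono-≤; *-monoˡ-≤-nonNeg; <⇒≤; ≤-trans; module ≤-Reasoning)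
open import Data.Rational.Solver using (module +-*-Solver)
import Data.Rational.Unnormalised as ℚᵘ
import Data.Rational.Unnormalised.Properties as ℚᵘ
open import Data.Sum using (_⊎_; inj₁; inj₂)
open import Data.Vec using ([]; _∷_; here; there; _++_)
open import Data.Vec.Properties using (map-++)
open import Function using (_∘_)
open import Function.Bundles using (_⇔_; mk⇔; Equivalence)
import Function.Properties.Equivalence as ⇔
open import Relation.Nullary using (¬_; does; yes; no; ¬?)
open import Relation.Nullary.Decidable using (decidable-stable; _×-dec_)
open import Relation.Unary using (Pred; Decidable)
open import Relation.Unary.Properties using (_∪?_; _∩?_)
open import Relation.Binary.PropositionalEquality
  using (_≡_; _≢_; refl; sym; trans; cong; cong₂; subst; subst₂; module ≡-Reasoning)

open +-*-Solver

private variable m n : ℕ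

module _ {a p} {A : Set a} {P : Pred A p} (P? : Decidable P) where

  length-filter-map : ∀ {b} {B : Set b} (f : B → A) (xs : List B) →
                      length (filter P? (map f xs)) ≡ length (filter (P? ∘ f) xs)
  length-filter-map f []       = refl
  length-filter-map f (x ∷ xs) with does (P? (f x))
  ... | true  = cong ℕ.suc (length-filter-map f xs)
  ... | false = length-filter-map f xs

  filter-concat-tabulate : (F : Fin n → List A) (i : Fin n) →
                           (∀ j → j ≢ i → All (¬_ ∘ P) (F j)) →
                           filter P? (concat (tabulate F)) ≡ filter P? (F i)
  filter-concat-tabulate {ℕ.suc n} F zero others = begin
    filter P? (F zero List.++ rest)                ≡⟨ filter-++ P? (F zero) rest ⟩
    filter P? (F zero) List.++ filter P? rest
                                                   ≡⟨ cong (filter P? (F zero) List.++_) (filter-none P? restRejected) ⟩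
    filter P? (F zero) List.++ []                  ≡⟨ ++-identityʳ _ ⟩
    filter P? (F zero)                             ∎
    where
    open ≡-Reasoning
    rest : List A
    rest = concat (tabulate (F ∘ suc))
    restRejected : All (¬_ ∘ P) rest
    restRejected = concat⁺ (tabulate⁺ λ j → others (suc j) λ ())
  filter-concat-tabulate {ℕ.suc n} F (suc i) others = begin
    filter P? (F zero List.++ rest)                ≡⟨ filter-++ P? (F zero) rest ⟩
    filter P? (F zero) List.++ filter P? rest
                                                   ≡⟨ cong (List._++ filter P? rest) (filter-none P? (others zero λ ())) ⟩
    filter P? rest                                 ≡⟨ filter-concat-tabulate (F ∘ suc) i othersAfterZero ⟩
    filter P? (F (suc i))                          ∎
    where
    open ≡-Reasoning
    rest : List A
    rest = concat (tabulate (F ∘ suc))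
    othersAfterZero : ∀ j → j ≢ i → All (¬_ ∘ P) (F (suc j))
    othersAfterZero j j≢i = others (suc j) (j≢i ∘ suc-injective)

module _ {a p q} {A : Set a} {P : Pred A p} {Q : Pred A q} (P? : Decidable P) (Q? : Decidable Q) where

  length-filter-cong : (∀ x → P x ⇔ Q x) → ∀ xs → length (filter P? xs) ≡ length (filter Q? xs)
  length-filter-cong P⇔Q xs =
    cong length (filter-≐ P? Q? (Equivalence.to (P⇔Q _) , Equivalence.from (P⇔Q _)) xs)

  length-filter-∪+∩ : ∀ xs → length (filter P? xs) ℕ.+ length (filter Q? xs)
                           ≡ length (filter (P? ∪? Q?) xs) ℕ.+ length (filter (P? ∩? Q?) xs)
  length-filter-∪+∩ []       = refl
  length-filter-∪+∩ (x ∷ xs) with ih ← length-filter-∪+∩ xs | does (P? x) | does (Q? x)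
  ... | true  | true  = cong ℕ.suc (trans (ℕ.+-suc _ _) (trans (cong ℕ.suc ih) (sym (ℕ.+-suc _ _))))
  ... | true  | false = cong ℕ.suc ih
  ... | false | true  = trans (ℕ.+-suc _ _) (cong ℕ.suc ih)
  ... | false | false = ih

nonempty-∩⇔⊈∁ : (p q : Subset n) → Nonempty (p ∩ q) ⇔ (¬ p ⊆ ∁ q)
nonempty-∩⇔⊈∁ p q = mk⇔ to from
  where
  to : Nonempty (p ∩ q) → ¬ p ⊆ ∁ q
  to (_ , x∈p∩q) p⊆∁q with x∈p , x∈q ← x∈p∩q⁻ p q x∈p∩q = x∈p⇒x∉∁p x∈q (p⊆∁q x∈p)
  from : ¬ p ⊆ ∁ q → Nonempty (p ∩ q)
  from p⊈∁q = decidable-stable (nonempty? (p ∩ q)) λ empty →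
    p⊈∁q λ x∈p → x∉p⇒x∈∁p λ x∈q → empty (_ , x∈p∩q⁺ (x∈p , x∈q))

nonempty-∩∁⇔⊈ : (p q : Subset n) → Nonempty (p ∩ ∁ q) ⇔ (¬ p ⊆ q)
nonempty-∩∁⇔⊈ p q = mk⇔ to from
  where
  to : Nonempty (p ∩ ∁ q) → ¬ p ⊆ q
  to (_ , x∈p∩∁q) p⊆q with x∈p , x∈∁q ← x∈p∩q⁻ p (∁ q) x∈p∩∁q = x∈p⇒x∉∁p (p⊆q x∈p) x∈∁q
  from : ¬ p ⊆ q → Nonempty (p ∩ ∁ q)
  from p⊈q = decidable-stable (nonempty? (p ∩ ∁ q)) λ empty →
    p⊈q λ x∈p → x∉∁p⇒x∈p λ x∈∁q → empty (_ , x∈p∩q⁺ (x∈p , x∈∁q))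

⊈⊎⊈∁⇔⊈⊥ : (p q : Subset n) → (¬ p ⊆ q ⊎ ¬ p ⊆ ∁ q) ⇔ (¬ p ⊆ ⊥)
⊈⊎⊈∁⇔⊈⊥ p q = mk⇔ to from
  where
  to : ¬ p ⊆ q ⊎ ¬ p ⊆ ∁ q → ¬ p ⊆ ⊥
  to (inj₁ p⊈q)  p⊆⊥ = p⊈q λ x∈p → ⊥-elim (∉⊥ (p⊆⊥ x∈p))
  to (inj₂ p⊈∁q) p⊆⊥ = p⊈∁q λ x∈p → ⊥-elim (∉⊥ (p⊆⊥ x∈p))
  from : ¬ p ⊆ ⊥ → ¬ p ⊆ q ⊎ ¬ p ⊆ ∁ q
  from p⊈⊥ with p ⊆? q
  ... | no  p⊈q = inj₁ p⊈q
  ... | yes p⊆q = inj₂ λ p⊆∁q → p⊈⊥ λ x∈p → ⊥-elim (x∈p⇒x∉∁p (p⊆q x∈p) (p⊆∁q x∈p))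

∈-++⁺ˡ : ∀ {p : Subset m} {q : Subset n} {x} → x ∈ p → x ↑ˡ n ∈ p ++ q
∈-++⁺ˡ here        = here
∈-++⁺ˡ (there x∈p) = there (∈-++⁺ˡ x∈p)

∈-++⁺ʳ : ∀ (p : Subset m) {q : Subset n} {x} → x ∈ q → m ↑ʳ x ∈ p ++ q
∈-++⁺ʳ []      x∈q = x∈q
∈-++⁺ʳ (_ ∷ p) x∈q = there (∈-++⁺ʳ p x∈q)

nonempty-++⁻ : ∀ (p : Subset m) {q : Subset n} → Nonempty (p ++ q) → Nonempty p ⊎ Nonempty q
nonempty-++⁻ []      ne                = inj₂ ne
nonempty-++⁻ (_ ∷ p) (_ , here)        = inj₁ (_ , here)
nonempty-++⁻ (_ ∷ p) (_ , there x∈p++q) with nonempty-++⁻ p (_ , x∈p++q)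
... | inj₁ (_ , x∈p) = inj₁ (_ , there x∈p)
... | inj₂ ne        = inj₂ ne

nonempty-⊥++⇔ : (q : Subset n) → Nonempty (⊥ {m} ++ q) ⇔ Nonempty q
nonempty-⊥++⇔ q = mk⇔ to (λ (_ , x∈q) → _ , ∈-++⁺ʳ ⊥ x∈q)
  where
  to : Nonempty (⊥ ++ q) → Nonempty q
  to ne with nonempty-++⁻ ⊥ ne
  ... | inj₁ (_ , x∈⊥) = ⊥-elim (∉⊥ x∈⊥)
  ... | inj₂ ne′       = ne′

nonempty-++⊥⇔ : (p : Subset m) → Nonempty (p ++ ⊥ {n}) ⇔ Nonempty p
nonempty-++⊥⇔ p = mk⇔ to (λ (_ , x∈p) → _ , ∈-++⁺ˡ x∈p)
  where
  to : Nonempty (p ++ ⊥) → Nonempty p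
  to ne with nonempty-++⁻ p ne
  ... | inj₁ ne′       = ne′
  ... | inj₂ (_ , x∈⊥) = ⊥-elim (∉⊥ x∈⊥)

∩-++ : (p₁ q₁ : Subset m) (p₂ q₂ : Subset n) → (p₁ ++ p₂) ∩ (q₁ ++ q₂) ≡ (p₁ ∩ q₁) ++ (p₂ ∩ q₂)
∩-++ []       []       p₂ q₂ = refl
∩-++ (x ∷ p₁) (y ∷ q₁) p₂ q₂ = cong (x ∧ y ∷_) (∩-++ p₁ q₁ p₂ q₂)

nonempty-⁅⁆∩⁅⁆⇔ : (i j : Fin n) → Nonempty (⁅ i ⁆ ∩ ⁅ j ⁆) ⇔ i ≡ j
nonempty-⁅⁆∩⁅⁆⇔ i j = mk⇔ to from
  where
  to : Nonempty (⁅ i ⁆ ∩ ⁅ j ⁆) → i ≡ j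
  to (_ , x∈⁅i⁆∩⁅j⁆) with x∈⁅i⁆ , x∈⁅j⁆ ← x∈p∩q⁻ ⁅ i ⁆ ⁅ j ⁆ x∈⁅i⁆∩⁅j⁆ =
    trans (sym (x∈⁅y⁆⇒x≡y i x∈⁅i⁆)) (x∈⁅y⁆⇒x≡y j x∈⁅j⁆)
  from : i ≡ j → Nonempty (⁅ i ⁆ ∩ ⁅ j ⁆)
  from refl = i , x∈p∩q⁺ (x∈⁅x⁆ i , x∈⁅x⁆ i)

numLeaving : UHypergraph n → Subset n → ℕ
numLeaving E X = length (filter (λ e → ¬? (e ⊆? X)) E)

cutU+numLeaving-⊥ : (E : UHypergraph n) (S : Subset n) →
                    cutU E S ℕ.+ numLeaving E ⊥ ≡ numLeaving E S ℕ.+ numLeaving E (∁ S)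
cutU+numLeaving-⊥ E S = begin
  cutU E S ℕ.+ numLeaving E ⊥
    ≡⟨ cong₂ ℕ._+_ (length-filter-cong _ (⊈S? ∩? ⊈∁S?) crossing⇔ E)
                   (length-filter-cong _ (⊈S? ∪? ⊈∁S?) nonempty⇔ E) ⟩
  length (filter (⊈S? ∩? ⊈∁S?) E) ℕ.+ length (filter (⊈S? ∪? ⊈∁S?) E)
    ≡⟨ ℕ.+-comm (length (filter (⊈S? ∩? ⊈∁S?) E)) _ ⟩
  length (filter (⊈S? ∪? ⊈∁S?) E) ℕ.+ length (filter (⊈S? ∩? ⊈∁S?) E)
    ≡⟨ length-filter-∪+∩ ⊈S? ⊈∁S? E ⟨
  numLeaving E S ℕ.+ numLeaving E (∁ S)
    ∎
  where
  open ≡-Reasoning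
  ⊈S? : Decidable (λ e → ¬ e ⊆ S)
  ⊈∁S? : Decidable (λ e → ¬ e ⊆ ∁ S)
  ⊈S?  e = ¬? (e ⊆? S)
  ⊈∁S? e = ¬? (e ⊆? ∁ S)
  crossing⇔ : ∀ e → (Nonempty (e ∩ S) × ¬ e ⊆ S) ⇔ (¬ e ⊆ S × ¬ e ⊆ ∁ S)
  crossing⇔ e = mk⇔ (λ (meets , e⊈S) → e⊈S , Equivalence.to (nonempty-∩⇔⊈∁ e S) meets)
                    (λ (e⊈S , e⊈∁S) → Equivalence.from (nonempty-∩⇔⊈∁ e S) e⊈∁S , e⊈S)
  nonempty⇔ : ∀ e → (¬ e ⊆ ⊥) ⇔ (¬ e ⊆ S ⊎ ¬ e ⊆ ∁ S)
  nonempty⇔ e = ⇔.sym (⊈⊎⊈∁⇔⊈⊥ e S)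

-- Fin (n + n) is V followed by its twin copy V′, so ⊥ ++ ⁅ j ⁆ is the singleton {j′}.
arc : Fin n → Subset n → Subset (n ℕ.+ n) × Subset (n ℕ.+ n)
arc j e = ⊥ ++ ⁅ j ⁆ , e ++ ⊥

encode : (Fin n → UHypergraph n) → DHypergraph (n ℕ.+ n)
encode H = concat (tabulate λ j → map (arc j) (H j))

probe : Subset n → Fin n → Subset (n ℕ.+ n)
probe X i = X ++ ⁅ i ⁆

tail-meets-probe⇔ : (X : Subset n) (i j : Fin n) → Nonempty ((⊥ ++ ⁅ j ⁆) ∩ probe X i) ⇔ j ≡ i
tail-meets-probe⇔ X i j = subst (λ T → Nonempty T ⇔ j ≡ i) (sym tail∩probe)
                                  (⇔.trans (nonempty-⊥++⇔ (⁅ j ⁆ ∩ ⁅ i ⁆)) (nonempty-⁅⁆∩⁅⁆⇔ j i))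
  where
  tail∩probe : (⊥ ++ ⁅ j ⁆) ∩ probe X i ≡ ⊥ ++ (⁅ j ⁆ ∩ ⁅ i ⁆)
  tail∩probe = trans (∩-++ ⊥ X ⁅ j ⁆ ⁅ i ⁆) (cong (_++ (⁅ j ⁆ ∩ ⁅ i ⁆)) (∩-zeroˡ X))

head-leaves-probe⇔ : (X e : Subset n) (i : Fin n) → Nonempty ((e ++ ⊥) ∩ ∁ (probe X i)) ⇔ (¬ e ⊆ X)
head-leaves-probe⇔ X e i = subst (λ T → Nonempty T ⇔ (¬ e ⊆ X)) (sym head∩∁probe)
                                   (⇔.trans (nonempty-++⊥⇔ (e ∩ ∁ X)) (nonempty-∩∁⇔⊈ e X))
  where
  open ≡-Reasoning
  head∩∁probe : (e ++ ⊥) ∩ ∁ (probe X i) ≡ (e ∩ ∁ X) ++ ⊥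
  head∩∁probe = begin
    (e ++ ⊥) ∩ ∁ (X ++ ⁅ i ⁆)         ≡⟨ cong ((e ++ ⊥) ∩_) (map-++ not X ⁅ i ⁆) ⟩
    (e ++ ⊥) ∩ (∁ X ++ ∁ ⁅ i ⁆)       ≡⟨ ∩-++ e (∁ X) ⊥ (∁ ⁅ i ⁆) ⟩
    (e ∩ ∁ X) ++ (⊥ ∩ ∁ ⁅ i ⁆)        ≡⟨ cong ((e ∩ ∁ X) ++_) (∩-zeroˡ (∁ ⁅ i ⁆)) ⟩
    (e ∩ ∁ X) ++ ⊥                    ∎

cutD-encode-probe : (H : Fin n → UHypergraph n) (X : Subset n) (i : Fin n) →
                    cutD (encode H) (probe X i) ≡ numLeaving (H i) X
cutD-encode-probe {n} H X i = begin
  length (filter crosses? (encode H))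
                                                    ≡⟨ cong length (filter-concat-tabulate crosses? _ i notCrossing) ⟩
  length (filter crosses? (map (arc i) (H i)))      ≡⟨ length-filter-map crosses? (arc i) (H i) ⟩
  length (filter (crosses? ∘ arc i) (H i))          ≡⟨ length-filter-cong _ _ crosses⇔ (H i) ⟩
  numLeaving (H i) X                                ∎
  where
  open ≡-Reasoning
  T : Subset (n ℕ.+ n)
  T = probe X i
  Crosses : Subset (n ℕ.+ n) × Subset (n ℕ.+ n) → Set
  Crosses a = Nonempty (proj₁ a ∩ T) × Nonempty (proj₂ a ∩ ∁ T)
  crosses? : Decidable Crosses
  crosses? a = nonempty? (proj₁ a ∩ T) ×-dec nonempty? (proj₂ a ∩ ∁ T)
  notCrossing : ∀ j → j ≢ i → All (¬_ ∘ Crosses) (map (arc j) (H j))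
  notCrossing j j≢i =
    map⁺ (universal (λ e (tailMeets , _) → j≢i (Equivalence.to (tail-meets-probe⇔ X i j) tailMeets)) (H j))
  crosses⇔ : ∀ e → Crosses (arc i e) ⇔ (¬ e ⊆ X)
  crosses⇔ e = mk⇔ (λ (_ , headLeaves) → Equivalence.to (head-leaves-probe⇔ X e i) headLeaves)
                   (λ e⊈X → Equivalence.from (tail-meets-probe⇔ X i i) refl ,
                            Equivalence.from (head-leaves-probe⇔ X e i) e⊈X)

-- `toℚ k` goes through gcd-normalisation, which does not compute for a variable k.
toℚ≡mkℚ : ∀ k → toℚ k ≡ mkℚ (+ k) 0 (Coprimality.sym (Coprimality.1-coprimeTo k))
toℚ≡mkℚ k = normalize-coprime (Coprimality.sym (Coprimality.1-coprimeTo k))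

toℚ-homo-+ : ∀ a b → toℚ (a ℕ.+ b) ≡ toℚ a + toℚ b
toℚ-homo-+ a b = toℚᵘ-injective (ℚᵘ.≃-trans unnormalised (ℚᵘ.≃-sym (toℚᵘ-homo-+ (toℚ a) (toℚ b))))
  where
  unnormalised : toℚᵘ (toℚ (a ℕ.+ b)) ℚᵘ.≃ toℚᵘ (toℚ a) ℚᵘ.+ toℚᵘ (toℚ b)
  unnormalised rewrite toℚ≡mkℚ (a ℕ.+ b) | toℚ≡mkℚ a | toℚ≡mkℚ b = ℚᵘ.*≡* (begin
    + (a ℕ.+ b) ℤ.* + 1           ≡⟨ ℤ.*-identityʳ _ ⟩
    + (a ℕ.+ b)                   ≡⟨ ℤ.pos-+ a b ⟩
    + a ℤ.+ + b                   ≡⟨ cong₂ ℤ._+_ (ℤ.*-identityʳ (+ a)) (ℤ.*-identityʳ (+ b)) ⟨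
    + a ℤ.* + 1 ℤ.+ + b ℤ.* + 1   ≡⟨ ℤ.*-identityʳ _ ⟨
    (+ a ℤ.* + 1 ℤ.+ + b ℤ.* + 1) ℤ.* + 1 ∎)
    where open ≡-Reasoning

toℚ-mono-≤ : ∀ {a b} → a ℕ.≤ b → toℚ a ≤ toℚ b
toℚ-mono-≤ {a} {b} a≤b rewrite toℚ≡mkℚ a | toℚ≡mkℚ b =
  *≤* (subst₂ ℤ._≤_ (sym (ℤ.*-identityʳ (+ a))) (sym (ℤ.*-identityʳ (+ b))) (ℤ.+≤+ a≤b))

toℚ-+-cancel : ∀ {a b c d} → a ℕ.+ b ≡ c ℕ.+ d → toℚ a ≡ toℚ c + toℚ d - toℚ b
toℚ-+-cancel {a} {b} {c} {d} eq = begin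
  toℚ a                         ≡⟨ solve 2 (λ x y → x := x :+ y :- y) refl (toℚ a) (toℚ b) ⟩
  toℚ a + toℚ b - toℚ b         ≡⟨ cong (_- toℚ b) (toℚ-homo-+ a b) ⟨
  toℚ (a ℕ.+ b) - toℚ b         ≡⟨ cong (λ k → toℚ k - toℚ b) eq ⟩
  toℚ (c ℕ.+ d) - toℚ b         ≡⟨ cong (_- toℚ b) (toℚ-homo-+ c d) ⟩
  toℚ c + toℚ d - toℚ b         ∎
  where open ≡-Reasoning

∣p∣≤q : ∀ {p q} → p ≤ q → - p ≤ q → ∣ p ∣ ≤ q
∣p∣≤q {p} p≤q -p≤q with ∣p∣≡p∨∣p∣≡-p p
... | inj₁ ∣p∣≡p  = subst (_≤ _) (sym ∣p∣≡p) p≤q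
... | inj₂ ∣p∣≡-p = subst (_≤ _) (sym ∣p∣≡-p) -p≤q

∣p-q∣≤ε*q : ∀ ε p q → (1ℚ - ε) * q ≤ p × p ≤ (1ℚ + ε) * q → ∣ p - q ∣ ≤ ε * q
∣p-q∣≤ε*q ε p q (lower , upper) = ∣p∣≤q above below
  where
  open ≤-Reasoning
  above : p - q ≤ ε * q
  above = begin
    p - q                  ≤⟨ +-monoˡ-≤ (- q) upper ⟩
    (1ℚ + ε) * q - q       ≡⟨ solve 2 (λ e c → (con 1ℚ :+ e) :* c :- c := e :* c) refl ε q ⟩
    ε * q                  ∎
  below : - (p - q) ≤ ε * q
  below = begin
    - (p - q)              ≡⟨ solve 2 (λ x y → :- (x :- y) := y :- x) refl p q ⟩
    q - p                  ≤⟨ +-monoʳ-≤ q (neg-antimono-≤ lower) ⟩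
    q - (1ℚ - ε) * q       ≡⟨ solve 2 (λ e c → c :- (con 1ℚ :- e) :* c := e :* c) refl ε q ⟩
    ε * q                  ∎

∣[p+q-r]-[x+y-z]∣≤ : ∀ p q r x y z →
  ∣ (p + q - r) - (x + y - z) ∣ ≤ ∣ p - x ∣ + ∣ q - y ∣ + ∣ r - z ∣
∣[p+q-r]-[x+y-z]∣≤ p q r x y z = begin
  ∣ (p + q - r) - (x + y - z) ∣         ≡⟨ cong ∣_∣ (solve 6 (λ p q r x y z →
                                             (p :+ q :- r) :- (x :+ y :- z) := ((p :- x) :+ (q :- y)) :- (r :- z))
                                             refl p q r x y z) ⟩
  ∣ ((p - x) + (q - y)) - (r - z) ∣     ≤⟨ ∣p-q∣≤∣p∣+∣q∣ ((p - x) + (q - y)) (r - z) ⟩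
  ∣ (p - x) + (q - y) ∣ + ∣ r - z ∣     ≤⟨ +-monoˡ-≤ ∣ r - z ∣ (∣p+q∣≤∣p∣+∣q∣ (p - x) (q - y)) ⟩
  ∣ p - x ∣ + ∣ q - y ∣ + ∣ r - z ∣     ∎
  where open ≤-Reasoning

decode : (n : ℕ) → ℚ → (Subset (n ℕ.+ n) → ℚ) → Fin n → Subset n → ℚ
decode n _ f i S = f (probe S i) + f (probe (∁ S) i) - f (probe ⊥ i)

decode-error : (H : Fin n → UHypergraph n) (ε : ℚ) → 0ℚ < ε → (f : Subset (n ℕ.+ n) → ℚ) →
               ((T : Subset (n ℕ.+ n)) →
                  (1ℚ - ε) * toℚ (cutD (encode H) T) ≤ f T × f T ≤ (1ℚ + ε) * toℚ (cutD (encode H) T)) →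
               (i : Fin n) (S : Subset n) →
               ∣ decode n ε f i S - toℚ (cutU (H i) S) ∣ ≤ toℚ 3 * ε * toℚ (numEdges (H i))
decode-error {n} H ε 0<ε f sketch i S = begin
  ∣ decode n ε f i S - toℚ (cutU (H i) S) ∣
    ≡⟨ cong (λ c → ∣ decode n ε f i S - c ∣) cut≡ ⟩
  ∣ decode n ε f i S - (c S + c (∁ S) - c ⊥) ∣
    ≤⟨ ∣[p+q-r]-[x+y-z]∣≤ (f (probe S i)) (f (probe (∁ S) i)) (f (probe ⊥ i)) (c S) (c (∁ S)) (c ⊥) ⟩
  ∣ f (probe S i) - c S ∣ + ∣ f (probe (∁ S) i) - c (∁ S) ∣ + ∣ f (probe ⊥ i) - c ⊥ ∣
    ≤⟨ +-mono-≤ (+-mono-≤ (probe-error S) (probe-error (∁ S))) (probe-error ⊥) ⟩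
  ε * N + ε * N + ε * N
    ≡⟨ solve 2 (λ e k → e :* k :+ e :* k :+ e :* k := (con 1ℚ :+ con 1ℚ :+ con 1ℚ) :* e :* k) refl ε N ⟩
  toℚ 3 * ε * N ∎
  where
  open ≤-Reasoning
  c : Subset n → ℚ
  c X = toℚ (numLeaving (H i) X)
  N : ℚ
  N = toℚ (numEdges (H i))
  cut≡ : toℚ (cutU (H i) S) ≡ c S + c (∁ S) - c ⊥
  cut≡ = toℚ-+-cancel {cutU (H i) S} {numLeaving (H i) ⊥} {numLeaving (H i) S} {numLeaving (H i) (∁ S)}
                      (cutU+numLeaving-⊥ (H i) S)
  probe-sandwich : ∀ X → (1ℚ - ε) * c X ≤ f (probe X i) × f (probe X i) ≤ (1ℚ + ε) * c X
  probe-sandwich X = subst (λ k → (1ℚ - ε) * toℚ k ≤ f (probe X i) × f (probe X i) ≤ (1ℚ + ε) * toℚ k)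
                           (cutD-encode-probe H X i) (sketch (probe X i))
  probe-error : ∀ X → ∣ f (probe X i) - c X ∣ ≤ ε * N
  probe-error X = ≤-trans (∣p-q∣≤ε*q ε _ _ (probe-sandwich X))
                          (*-monoˡ-≤-nonNeg ε {{nonNegative (<⇒≤ 0<ε)}} (toℚ-mono-≤ (length-filter _ (H i))))

theorem1p4 : Σ ((n : ℕ) → ℚ → ((Subset (n ℕ.+ n)) → ℚ) → Fin n → Subset n → ℚ) (λ decode →
    (n : ℕ) (H : Fin n → UHypergraph n) →
    Σ (DHypergraph (n ℕ.+ n)) (λ G →
      (ε : ℚ) → 0ℚ < ε →
      (f : Subset (n ℕ.+ n) → ℚ) →
      ((T : Subset (n ℕ.+ n)) → ((1ℚ - ε) * toℚ (cutD G T) ≤ f T) × ((f T) ≤ ((1ℚ + ε) * toℚ (cutD G T)))) →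
      (i : Fin n) (S : Subset n) →
      ∣ decode n ε f i S - toℚ (cutU (H i) S) ∣ ≤ toℚ 3 * ε * toℚ (numEdges (H i))))
theorem1p4 = decode , λ n H → encode H , decode-error H
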